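{- Let $n=4k+2$ for some integer $k\geq 0$, and let $v\in\mathbb{Z}^n$ be a column of some $n$-icube in $\mathbb{Z}^n$. Then $|v|^2=v^Tv\in\mathbb{Z}$ is a sum of two squares of integers.
   Context: For $1\leq k\leq n$, a matrix $(v_1|\dots|v_k)\in\mathbb{Z}^{n\times k}$ is a $k$-icube in $\mathbb{Z}^n$ of norm $\lambda>0$ if $v_i^Tv_j=\lambda$ for $i=j$ and $v_i^Tv_j=0$ for $i\neq j$. An $n$-icube in $\mathbb{Z}^n$ is thus a matrix $A\in\mathbb{Z}^{n\times n}$ with $A^TA=\lambda I$, $\lambda>0$. -}

module Defs where

open import Data.Nat using (ℕ)
open import Data.Integer using (ℤ; +_; _+_; _*_; _>_)
open import Data.Fin using (Fin; zero; suc)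
open import Data.Vec.Functional using (Vector)
open import Relation.Binary.PropositionalEquality using (_≡_)
open import Relation.Nullary using (¬_)
open import Data.Product using (_×_; ∃-syntax)

Σ[_] : (n : ℕ) → (Fin n → ℤ) → ℤ
Σ[ 0 ] f = + 0
Σ[ ℕ.suc n ] f = f zero + Σ[ n ] (λ i → f (suc i))

-- Integer matrices with m rows and k columns: A i j = entry in row i, column j
Matrix : ℕ → ℕ → Set
Matrix m k = Fin m → Fin k → ℤ

column : ∀ {m k} → Matrix m k → Fin k → Vector ℤ m
column A j i = A i j

dot : ∀ {n} → Vector ℤ n → Vector ℤ n → ℤ
dot {n} u v = Σ[ n ] (λ i → u i * v i)

IsIcube : (n k : ℕ) → Matrix n k → ℤ → Set
IsIcube n k A λ′ =
  (λ′ > + 0) ×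
  (∀ i → dot (column A i) (column A i) ≡ λ′) ×
  (∀ i j → ¬ (i ≡ j) → dot (column A i) (column A j) ≡ + 0)

IsIcubeColumn : (n : ℕ) → Vector ℤ n → Set
IsIcubeColumn n v =
  ∃[ A ] ∃[ λ′ ] IsIcube n n A λ′ × ∃[ j ] (∀ i → column A j i ≡ v i)

SumOfTwoSquares : ℤ → Set
SumOfTwoSquares z = ∃[ a ] ∃[ b ] z ≡ a * a + b * b

{-# OPTIONS --safe #-}
module Submission where

-- Let c be the common squared length of the columns. Reading the icube row by row, AᵀA = c I says
-- that c (y₁² + … + yₙ²) is a sum of n squares of integer linear forms. By Lagrange's theorem
-- c = |q|² for an integer quaternion q, and left multiplication by q turns c I₄ into c² I₄, a square
-- multiple of I₄ which Witt cancellation removes; so over ℚ the form c I_{n-4} is still a sum of n - 4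
-- squares. Going down from n = 4k + 2 to 2 shows that c is a sum of two rational squares, and the
-- Davenport–Cassels descent for x² + y² makes them integral.
--
-- Lagrange's theorem is proved by Euler's descent on m in |x|² = m p, starting from a solution of
-- x² + y² + 1 ≡ 0 (mod p) found by the pigeonhole principle.

open import Defs
open import Data.Fin.Base as Fin using (Fin; zero; suc; toℕ; fromℕ<; splitAt; join; punchIn)
open import Data.Fin.Properties as Fin using (punchInᵢ≢i; toℕ<n; toℕ-fromℕ<; toℕ-injective; join-splitAt; pigeonhole)
open import Data.Product using (_×_; _,_; ∃-syntax)
open import Data.Sum using (_⊎_; inj₁; inj₂; [_,_])
open import Relation.Binary.Definitions using (tri<; tri≈; tri>)
open import Data.Vec.Functional using (Vector; _∷_; []; _++_; replicate; map; tail; drop; removeAt)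
open import Function using (_∘_; id)
open import Relation.Binary.PropositionalEquality using (_≡_; _≢_; refl; sym; trans; cong; cong₂; subst; module ≡-Reasoning)
open import Relation.Nullary using (¬_; Dec; yes; no; contradiction)
open import Data.Empty using (⊥; ⊥-elim)

module _ where
  open import Data.Nat.Base as ℕ using (ℕ)
  import Data.Nat.Properties as ℕ
  import Data.Nat.Divisibility as ℕ
  open import Data.Nat.Induction using (<-rec)
  open import Data.Nat.Primality using (Prime; composite; prime⇒¬composite; prime⇒nonZero; prime⇒nonTrivial; euclidsLemma)
  open import Data.Nat.Primality.Factorisation using (PrimeFactorisation; factorise)
  open import Data.Nat.ListAction using (product)
  import Data.List.Base as List
  open import Data.List.Relation.Unary.All as All using (All)
  open import Data.Integer.Base
    using (ℤ; +_; -[1+_]; +[1+_]; 0ℤ; 1ℤ; -1ℤ; _+_; _*_; _-_; -_; ∣_∣; _⊖_; _>_; ≢-nonZero; _/ℕ_; _%ℕ_)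
  open import Data.Integer.DivMod using (a≡a%ℕn+[a/ℕn]*n; n%ℕd<d)
  open import Data.Integer.Properties
  open import Data.Integer.Tactic.RingSolver using (solve-∀)
  open import Data.Nat.Tactic.RingSolver using () renaming (solve-∀ to ℕ-solve-∀)
  open import Algebra.Properties.Semiring.Sum +-*-semiring
    using (sum; sum-cong-≗; sum-remove; sum-replicate-zero; ∑-comm; ∑-distrib-+; *-distribˡ-sum; *-distribʳ-sum)
  open import Data.Integer.Divisibility.Signed
    using (_∣_; divides; ∣-refl; ∣ᵤ⇒∣; ∣⇒∣ᵤ; ∣m∣n⇒∣m+n; ∣n⇒∣m*n; ∣m⇒∣m*n; ∣m⇒∣-m)
  open import Algebra.Bundles using (AbelianGroup)
  open import Algebra.Properties.Group (AbelianGroup.group +-0-abelianGroup) using (∙-cancelˡ; ∙-cancelʳ)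
  open ≡-Reasoning

  -- Diagonal forms as sums of squares of linear forms

  Σ≡sum : ∀ n (f : Vector ℤ n) → Σ[ n ] f ≡ sum f
  Σ≡sum ℕ.zero    f = refl
  Σ≡sum (ℕ.suc n) f = cong (_+_ (f zero)) (Σ≡sum n (tail f))

  infix 7 _·_
  _·_ : ∀ {n} → Vector ℤ n → Vector ℤ n → ℤ
  u · v = sum (λ i → u i * v i)

  dot≡· : ∀ {n} (u v : Vector ℤ n) → dot u v ≡ u · v
  dot≡· {n} u v = Σ≡sum n _

  ‖_‖² : ∀ {n} → Vector ℤ n → ℤ
  ‖ v ‖² = v · v

  infixl 7 _*ᵥ_
  _*ᵥ_ : ∀ {r n} → Matrix r n → Vector ℤ n → Vector ℤ r
  (L *ᵥ y) i = L i · y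

  diagonal : ∀ {n} → Vector ℤ n → Vector ℤ n → ℤ
  diagonal w y = sum (λ j → w j * (y j * y j))

  -- Lᵀ L = diag w, stated as an identity of quadratic forms in y.
  record Gram {r n} (L : Matrix r n) (w : Vector ℤ n) : Set where
    constructor gram
    field squares≡diagonal : ∀ y → ‖ L *ᵥ y ‖² ≡ diagonal w y

  Gram-cong : ∀ {r n} {L : Matrix r n} {w w′ : Vector ℤ n} → (∀ j → w j ≡ w′ j) → Gram L w → Gram L w′
  Gram-cong w≗w′ (gram G) = gram (λ y → trans (G y) (sum-cong-≗ (λ j → cong (_* _) (w≗w′ j))))

  sum-δ : ∀ {n} (f : Vector ℤ n) j → (∀ l → j ≢ l → f l ≡ 0ℤ) → sum f ≡ f j
  sum-δ {ℕ.suc n} f j off = begin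
    sum f                     ≡⟨ sum-remove {i = j} f ⟩
    f j + sum (removeAt f j)  ≡⟨ cong (_+_ (f j)) (trans (sum-cong-≗ off′) (sum-replicate-zero n)) ⟩
    f j + 0ℤ                  ≡⟨ +-identityʳ (f j) ⟩
    f j                       ∎
    where
    off′ : ∀ l → f (punchIn j l) ≡ 0ℤ
    off′ l = off _ (punchInᵢ≢i j l ∘ sym)

  sum-* : ∀ {m n} (f : Vector ℤ m) (g : Vector ℤ n) → sum f * sum g ≡ sum (λ j → sum (λ l → f j * g l))
  sum-* f g = trans (*-distribʳ-sum (sum g) f) (sum-cong-≗ (λ j → *-distribˡ-sum (f j) g))

  orthogonal⇒Gram : ∀ {r n} (A : Matrix r n) (w : Vector ℤ n) →
    (∀ j → column A j · column A j ≡ w j) →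
    (∀ j l → j ≢ l → column A j · column A l ≡ 0ℤ) →
    Gram A w
  orthogonal⇒Gram A w norms orthogonal = gram identity
    where
    regroup : ∀ a y b z → (a * y) * (b * z) ≡ (y * z) * (a * b)
    regroup = solve-∀
    pull-out : ∀ {m} c (f : Vector ℤ m) {g : Vector ℤ m} → (∀ i → g i ≡ c * f i) → sum g ≡ c * sum f
    pull-out c f g≗cf = trans (sum-cong-≗ g≗cf) (sym (*-distribˡ-sum c f))
    identity : ∀ y → ‖ A *ᵥ y ‖² ≡ diagonal w y
    identity y = begin
      sum (λ i → (A i · y) * (A i · y))
        ≡⟨ sum-cong-≗ (λ i → sum-* (λ j → A i j * y j) (λ l → A i l * y l)) ⟩
      sum (λ i → sum (λ j → sum (λ l → (A i j * y j) * (A i l * y l))))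
        ≡⟨ ∑-comm (λ i j → sum (λ l → (A i j * y j) * (A i l * y l))) ⟩
      sum (λ j → sum (λ i → sum (λ l → (A i j * y j) * (A i l * y l))))
        ≡⟨ sum-cong-≗ (λ j → ∑-comm (λ i l → (A i j * y j) * (A i l * y l))) ⟩
      sum (λ j → sum (λ l → sum (λ i → (A i j * y j) * (A i l * y l))))
        ≡⟨ sum-cong-≗ (λ j → sum-cong-≗ (λ l →
             pull-out (y j * y l) (λ i → A i j * A i l) (λ i → regroup (A i j) (y j) (A i l) (y l)))) ⟩
      sum (λ j → sum (λ l → (y j * y l) * (column A j · column A l)))
        ≡⟨ sum-cong-≗ (λ j → sum-δ _ j (λ l j≢l →
             trans (cong ((y j * y l) *_) (orthogonal j l j≢l)) (*-zeroʳ (y j * y l)))) ⟩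
      sum (λ j → (y j * y j) * (column A j · column A j))
        ≡⟨ sum-cong-≗ (λ j → trans (cong ((y j * y j) *_) (norms j)) (*-comm (y j * y j) (w j))) ⟩
      diagonal w y ∎

  -- Witt cancellation

  *-≢0 : ∀ {i j} → i ≢ 0ℤ → j ≢ 0ℤ → i * j ≢ 0ℤ
  *-≢0 {i} i≢0 j≢0 ij≡0 with i*j≡0⇒i≡0∨j≡0 i ij≡0
  ... | inj₁ i≡0 = i≢0 i≡0
  ... | inj₂ j≡0 = j≢0 j≡0

  substitution : ∀ {n} → Vector ℤ n → ℤ → Vector ℤ n → Vector ℤ (ℕ.suc n)
  substitution c t z = c · z ∷ map (t *_) z

  transposed : ∀ {n} → Vector ℤ n → ℤ → Vector ℤ (ℕ.suc n) → Vector ℤ n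
  transposed c t a j = a zero * c j + t * a (suc j)

  substitution-transpose : ∀ {n} (c : Vector ℤ n) t a z → a · substitution c t z ≡ transposed c t a · z
  substitution-transpose c t a z = begin
    a zero * (c · z) + sum (λ j → a (suc j) * (t * z j))
      ≡⟨ cong (_+ _) (*-distribˡ-sum (a zero) (λ j → c j * z j)) ⟩
    sum (λ j → a zero * (c j * z j)) + sum (λ j → a (suc j) * (t * z j))
      ≡⟨ ∑-distrib-+ (λ j → a zero * (c j * z j)) (λ j → a (suc j) * (t * z j)) ⟨
    sum (λ j → a zero * (c j * z j) + a (suc j) * (t * z j))
      ≡⟨ sum-cong-≗ (λ j → regroup (a zero) (c j) (z j) (a (suc j)) t) ⟩
    transposed c t a · z ∎
    where
    regroup : ∀ a₀ c z a t → a₀ * (c * z) + a * (t * z) ≡ (a₀ * c + t * a) * z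
    regroup = solve-∀

  reduced : ∀ {r n} → Matrix (ℕ.suc r) (ℕ.suc n) → ℤ → Matrix r n
  reduced L t i = transposed (tail (L zero)) t (L (suc i))

  -- Witt cancellation of a square coefficient w₀ = e²: after the substitution y = (c · z , t z)
  -- with c the rest of the first row, the first form becomes (L₀₀ + t) (c · z) = e y₀,
  -- so its square cancels against w₀ y₀².
  split-square : ∀ {r n} (L : Matrix (ℕ.suc r) (ℕ.suc n)) (w : Vector ℤ (ℕ.suc n)) e t →
    w zero ≡ e * e → L zero zero + t ≡ e → Gram L w →
    Gram (reduced L t) (λ j → t * t * w (suc j))
  split-square L w e t w₀≡e² L₀₀+t≡e (gram G) = gram identity
    where
    identity : ∀ z → ‖ reduced L t *ᵥ z ‖² ≡ diagonal (λ j → t * t * w (suc j)) z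
    identity z = ∙-cancelˡ (w zero * (C * C)) _ _ (begin
      w zero * (C * C) + ‖ reduced L t *ᵥ z ‖²
        ≡⟨ cong₂ _+_ first-row (sum-cong-≗ (λ i → cong (λ x → x * x) (substitution-transpose c t (L (suc i)) z))) ⟨
      ‖ L *ᵥ y ‖²
        ≡⟨ G y ⟩
      w zero * (C * C) + sum (λ j → w (suc j) * ((t * z j) * (t * z j)))
        ≡⟨ cong (_+_ (w zero * (C * C))) (sum-cong-≗ (λ j → regroup (w (suc j)) t (z j))) ⟩
      w zero * (C * C) + diagonal (λ j → t * t * w (suc j)) z ∎)
      where
      c = tail (L zero)
      C = c · z
      y = substitution c t z
      regroup : ∀ w t z → w * ((t * z) * (t * z)) ≡ t * t * w * (z * z)
      regroup = solve-∀
      first-form : L zero · y ≡ e * C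
      first-form = begin
        L zero · y                                       ≡⟨ substitution-transpose c t (L zero) z ⟩
        sum (λ j → (L zero zero * c j + t * c j) * z j)  ≡⟨ sum-cong-≗ (λ j → factor (c j) (z j)) ⟩
        sum (λ j → e * (c j * z j))                      ≡⟨ *-distribˡ-sum e (λ j → c j * z j) ⟨
        e * C                                            ∎
        where
        factor : ∀ c z → (L zero zero * c + t * c) * z ≡ e * (c * z)
        factor c z = trans (distribute (L zero zero) t c z) (cong (_* (c * z)) L₀₀+t≡e)
          where
          distribute : ∀ a t c z → (a * c + t * c) * z ≡ (a + t) * (c * z)
          distribute = solve-∀
      first-row : (L zero · y) * (L zero · y) ≡ w zero * (C * C)
      first-row = begin
        (L zero · y) * (L zero · y)  ≡⟨ cong (λ x → x * x) first-form ⟩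
        (e * C) * (e * C)            ≡⟨ square-product e C ⟩
        (e * e) * (C * C)            ≡⟨ cong (_* (C * C)) w₀≡e² ⟨
        w zero * (C * C)             ∎
        where
        square-product : ∀ e C → (e * C) * (e * C) ≡ (e * e) * (C * C)
        square-product = solve-∀

  -- (s - a) - (- s - a) = 2 s ≢ 0, so the two signs cannot both fail.
  sign-avoiding : ∀ s a → s ≢ 0ℤ → ∃[ e ] e * e ≡ s * s × e - a ≢ 0ℤ
  sign-avoiding s a s≢0 with s - a ≟ 0ℤ
  ... | no s-a≢0 = s , refl , s-a≢0
  ... | yes s-a≡0 = - s , square-neg s , 2s≢0 ∘ difference
    where
    square-neg : ∀ s → - s * - s ≡ s * s
    square-neg = solve-∀
    twice : ∀ s a → (s - a) - (- s - a) ≡ + 2 * s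
    twice = solve-∀
    difference : - s - a ≡ 0ℤ → + 2 * s ≡ 0ℤ
    difference -s-a≡0 = trans (sym (twice s a)) (cong₂ _-_ s-a≡0 -s-a≡0)
    2s≢0 : + 2 * s ≢ 0ℤ
    2s≢0 = *-≢0 {+ 2} (λ ()) s≢0

  cancel-square : ∀ {r n} (L : Matrix (ℕ.suc r) (ℕ.suc n)) (w : Vector ℤ (ℕ.suc n)) s →
    s ≢ 0ℤ → w zero ≡ s * s → Gram L w →
    ∃[ t ] t ≢ 0ℤ × ∃[ L′ ] Gram {r} L′ (λ j → t * t * w (suc j))
  cancel-square L w s s≢0 w₀≡s² G with sign-avoiding s (L zero zero) s≢0
  ... | e , e²≡s² , t≢0 =
    e - L zero zero , t≢0 , reduced L (e - L zero zero) ,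
    split-square L w e (e - L zero zero) (trans w₀≡s² (sym e²≡s²)) (cancel (L zero zero) e) G
    where
    cancel : ∀ a e → a + (e - a) ≡ e
    cancel = solve-∀

  tail-++ : ∀ {a} {A : Set a} {m n} (u : Vector A (ℕ.suc m)) (v : Vector A n) j →
    tail (u ++ v) j ≡ (tail u ++ v) j
  tail-++ {m = m} u v j with splitAt m j
  ... | inj₁ _ = refl
  ... | inj₂ _ = refl

  map-++ : ∀ {a b} {A : Set a} {B : Set b} {m n} (f : A → B) (u : Vector A m) (v : Vector A n) j →
    map f (u ++ v) j ≡ (map f u ++ map f v) j
  map-++ {m = m} f u v j with splitAt m j
  ... | inj₁ _ = refl
  ... | inj₂ _ = refl

  replicate-++ : ∀ {a} {A : Set a} m {n} (x : A) j → (replicate m x ++ replicate n x) j ≡ x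
  replicate-++ m x j with splitAt m j
  ... | inj₁ _ = refl
  ... | inj₂ _ = refl

  cancel-squares : ∀ m {r n} (L : Matrix (m ℕ.+ r) (m ℕ.+ n)) x s (w : Vector ℤ n) →
    s ≢ 0ℤ → x ≡ s * s → Gram L (replicate m x ++ w) →
    ∃[ t ] t ≢ 0ℤ × ∃[ L′ ] Gram {r} L′ (λ j → t * t * w j)
  cancel-squares ℕ.zero L x s w _ _ G = 1ℤ , (λ ()) , L , Gram-cong (λ j → sym (*-identityˡ (w j))) G
  cancel-squares (ℕ.suc m) {r} L x s w s≢0 x≡s² G = continue (cancel-square L (replicate (ℕ.suc m) x ++ w) s s≢0 x≡s² G)
    where
    regroup : ∀ t s → t * t * (s * s) ≡ t * s * (t * s)
    regroup = solve-∀
    reassociate : ∀ t′ t w → t′ * t′ * (t * t * w) ≡ t′ * t * (t′ * t) * w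
    reassociate = solve-∀
    shift : ∀ c j → c * (replicate (ℕ.suc m) x ++ w) (suc j) ≡ (replicate m (c * x) ++ map (c *_) w) j
    shift c j = trans (cong (c *_) (tail-++ (replicate (ℕ.suc m) x) w j)) (map-++ (c *_) (replicate m x) w j)
    continue : ∃[ t ] t ≢ 0ℤ × ∃[ L′ ] Gram {m ℕ.+ r} L′ (λ j → t * t * (replicate (ℕ.suc m) x ++ w) (suc j)) →
      ∃[ t ] t ≢ 0ℤ × ∃[ L′ ] Gram {r} L′ (λ j → t * t * w j)
    continue (t , t≢0 , L′ , G′) =
      combine (cancel-squares m L′ (t * t * x) (t * s) (map (t * t *_) w) (*-≢0 t≢0 s≢0)
                 (trans (cong (t * t *_) x≡s²) (regroup t s)) (Gram-cong (shift (t * t)) G′))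
      where
      combine : ∃[ t′ ] t′ ≢ 0ℤ × ∃[ L″ ] Gram {r} L″ (λ j → t′ * t′ * (t * t * w j)) →
        ∃[ t ] t ≢ 0ℤ × ∃[ L′ ] Gram {r} L′ (λ j → t * t * w j)
      combine (t′ , t′≢0 , L″ , G″) = t′ * t , *-≢0 t′≢0 t≢0 , L″ , Gram-cong (λ j → reassociate t′ t (w j)) G″

  -- Integer quaternions

  record ℍ : Set where
    constructor quat
    field re i j k : ℤ

  conj : ℍ → ℍ
  conj (quat a b c d) = quat a (- b) (- c) (- d)

  infixl 7 _⋆_
  _⋆_ : ℍ → ℍ → ℍ
  quat a b c d ⋆ quat e f g h = quat
    (a * e - b * f - c * g - d * h)
    (a * f + b * e + c * h - d * g)
    (a * g - b * h + c * e + d * f)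
    (a * h + b * g - c * f + d * e)

  norm : ℍ → ℤ
  norm (quat a b c d) = (a * a + b * b) + (c * c + d * d)

  ⟨_,_⟩ : ℍ → ℍ → ℤ
  ⟨ quat a b c d , quat e f g h ⟩ = a * e + b * f + c * g + d * h

  norm-⋆ : ∀ p q → norm (p ⋆ q) ≡ norm p * norm q
  norm-⋆ (quat a b c d) (quat e f g h) = euler a b c d e f g h
    where
    euler : ∀ a b c d e f g h →
      let x₀ = a * e - b * f - c * g - d * h
          x₁ = a * f + b * e + c * h - d * g
          x₂ = a * g - b * h + c * e + d * f
          x₃ = a * h + b * g - c * f + d * e
      in (x₀ * x₀ + x₁ * x₁) + (x₂ * x₂ + x₃ * x₃)
         ≡ ((a * a + b * b) + (c * c + d * d)) * ((e * e + f * f) + (g * g + h * h))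
    euler = solve-∀

  SumOfFourSquares : ℤ → Set
  SumOfFourSquares c = ∃[ q ] c ≡ norm q

  four-squares-* : ∀ {a b} → SumOfFourSquares a → SumOfFourSquares b → SumOfFourSquares (a * b)
  four-squares-* (p , refl) (q , refl) = p ⋆ q , sym (norm-⋆ p q)

  ⋆-adjoint : ∀ q p r → ⟨ conj q ⋆ p , r ⟩ ≡ ⟨ p , q ⋆ r ⟩
  ⋆-adjoint (quat a b c d) (quat e f g h) (quat x y z w) = adjoint a b c d e f g h x y z w
    where
    adjoint : ∀ a b c d e f g h x y z w →
      (a * e - - b * f - - c * g - - d * h) * x + (a * f + - b * e + - c * h - - d * g) * y
        + (a * g - - b * h + - c * e + - d * f) * z + (a * h + - b * g - - c * f + - d * e) * w
      ≡ e * (a * x - b * y - c * z - d * w) + f * (a * y + b * x + c * w - d * z)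
        + g * (a * z - b * w + c * x + d * y) + h * (a * w + b * z - c * y + d * x)
    adjoint = solve-∀

  head₄ : ∀ {n} → Vector ℤ (4 ℕ.+ n) → ℍ
  head₄ v = quat (v zero) (v (suc zero)) (v (suc (suc zero))) (v (suc (suc (suc zero))))

  toVector : ℍ → Vector ℤ 4
  toVector q = ℍ.re q ∷ ℍ.i q ∷ ℍ.j q ∷ ℍ.k q ∷ []

  twist : ∀ {n} → ℍ → Vector ℤ (4 ℕ.+ n) → Vector ℤ (4 ℕ.+ n)
  twist q v = toVector (q ⋆ head₄ v) ++ drop 4 v

  ·-split : ∀ {n} (u v : Vector ℤ (4 ℕ.+ n)) → u · v ≡ ⟨ head₄ u , head₄ v ⟩ + drop 4 u · drop 4 v
  ·-split u v = regroup (u zero) (u (suc zero)) (u (suc (suc zero))) (u (suc (suc (suc zero))))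
                        (v zero) (v (suc zero)) (v (suc (suc zero))) (v (suc (suc (suc zero))))
                        (drop 4 u · drop 4 v)
    where
    regroup : ∀ a b c d e f g h x → a * e + (b * f + (c * g + (d * h + x))) ≡ a * e + b * f + c * g + d * h + x
    regroup = solve-∀

  diagonal-split : ∀ {n} W (w : Vector ℤ n) y →
    diagonal (replicate 4 W ++ w) y ≡ W * norm (head₄ y) + diagonal w (drop 4 y)
  diagonal-split W w y = regroup W (y zero) (y (suc zero)) (y (suc (suc zero))) (y (suc (suc (suc zero))))
                                 (diagonal w (drop 4 y))
    where
    regroup : ∀ W a b c d x → W * (a * a) + (W * (b * b) + (W * (c * c) + (W * (d * d) + x)))
                              ≡ W * ((a * a + b * b) + (c * c + d * d)) + x
    regroup = solve-∀

  twist-adjoint : ∀ {n} q (l y : Vector ℤ (4 ℕ.+ n)) → twist (conj q) l · y ≡ l · twist q y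
  twist-adjoint q l y = begin
    twist (conj q) l · y
      ≡⟨ ·-split (twist (conj q) l) y ⟩
    ⟨ conj q ⋆ head₄ l , head₄ y ⟩ + drop 4 l · drop 4 y
      ≡⟨ cong (_+ drop 4 l · drop 4 y) (⋆-adjoint q (head₄ l) (head₄ y)) ⟩
    ⟨ head₄ l , q ⋆ head₄ y ⟩ + drop 4 l · drop 4 y
      ≡⟨ ·-split l (twist q y) ⟨
    l · twist q y ∎

  Gram-twist : ∀ {r n} (L : Matrix r (4 ℕ.+ n)) W (w : Vector ℤ n) q →
    Gram L (replicate 4 W ++ w) → Gram (twist (conj q) ∘ L) (replicate 4 (W * norm q) ++ w)
  Gram-twist L W w q (gram G) = gram identity
    where
    identity : ∀ y → ‖ (twist (conj q) ∘ L) *ᵥ y ‖² ≡ diagonal (replicate 4 (W * norm q) ++ w) y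
    identity y = begin
      ‖ (twist (conj q) ∘ L) *ᵥ y ‖²
        ≡⟨ sum-cong-≗ (λ i → cong (λ x → x * x) (twist-adjoint q (L i) y)) ⟩
      ‖ L *ᵥ twist q y ‖²
        ≡⟨ G (twist q y) ⟩
      diagonal (replicate 4 W ++ w) (twist q y)
        ≡⟨ diagonal-split W w (twist q y) ⟩
      W * norm (q ⋆ head₄ y) + diagonal w (drop 4 y)
        ≡⟨ cong (λ x → W * x + diagonal w (drop 4 y)) (norm-⋆ q (head₄ y)) ⟩
      W * (norm q * norm (head₄ y)) + diagonal w (drop 4 y)
        ≡⟨ cong (_+ diagonal w (drop 4 y)) (*-assoc W (norm q) (norm (head₄ y))) ⟨
      W * norm q * norm (head₄ y) + diagonal w (drop 4 y)
        ≡⟨ diagonal-split (W * norm q) w y ⟨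
      diagonal (replicate 4 (W * norm q) ++ w) y ∎

  -- Rational similitudes

  -- The rational matrix L / S satisfies (L / S)ᵀ (L / S) = c I.
  RationalSimilitude : ℕ → ℤ → Set
  RationalSimilitude m c = ∃[ S ] S ≢ 0ℤ × ∃[ L ] Gram {m} {m} L (λ _ → c * (S * S))

  icube⇒similitude : ∀ {n c} (A : Matrix n n) → IsIcube n n A c → RationalSimilitude n c
  icube⇒similitude {c = c} A (_ , norms , orthogonal) =
    1ℤ , (λ ()) , A , Gram-cong (λ _ → sym (*-identityʳ c)) (orthogonal⇒Gram A (λ _ → c)
      (λ j → trans (sym (dot≡· (column A j) (column A j))) (norms j))
      (λ j l j≢l → trans (sym (dot≡· (column A j) (column A l))) (orthogonal j l j≢l)))

  icube-column-norm : ∀ {n c} (A : Matrix n n) j (v : Vector ℤ n) → IsIcube n n A c →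
    (∀ i → column A j i ≡ v i) → dot v v ≡ c
  icube-column-norm {c = c} A j v (_ , norms , _) column≡v = begin
    dot v v                          ≡⟨ dot≡· v v ⟩
    v · v                            ≡⟨ sum-cong-≗ (λ i → cong₂ _*_ (column≡v i) (column≡v i)) ⟨
    column A j · column A j          ≡⟨ dot≡· (column A j) (column A j) ⟨
    dot (column A j) (column A j)    ≡⟨ norms j ⟩
    c                                ∎

  -- Twisting by q turns c S² I₄ into c² S² I₄ = (c S)² I₄, which Witt cancellation removes.
  similitude-shrink : ∀ m c q → c ≡ norm q → c ≢ 0ℤ → RationalSimilitude (4 ℕ.+ m) c → RationalSimilitude m c
  similitude-shrink m c q c≡|q|² c≢0 (S , S≢0 , L , G) =
    rescale (cancel-squares 4 (twist (conj q) ∘ L) (W * norm q) (c * S) (λ _ → W) (*-≢0 c≢0 S≢0)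
               (trans (cong (W *_) (sym c≡|q|²)) (square c S))
               (Gram-twist L W (λ _ → W) q (Gram-cong (λ j → sym (replicate-++ 4 W j)) G)))
    where
    W = c * (S * S)
    square : ∀ c S → c * (S * S) * c ≡ c * S * (c * S)
    square = solve-∀
    regroup : ∀ t c S → t * t * (c * (S * S)) ≡ c * (t * S * (t * S))
    regroup = solve-∀
    rescale : ∃[ t ] t ≢ 0ℤ × ∃[ L′ ] Gram {m} L′ (λ j → t * t * W) → RationalSimilitude m c
    rescale (t , t≢0 , L′ , G′) = t * S , *-≢0 t≢0 S≢0 , L′ , Gram-cong (λ _ → regroup t c S) G′

  similitude-descend : ∀ k m c → SumOfFourSquares c → c ≢ 0ℤ →
    RationalSimilitude (4 ℕ.* k ℕ.+ m) c → RationalSimilitude m c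
  similitude-descend ℕ.zero    m c _ _ sim = sim
  similitude-descend (ℕ.suc k) m c (q , c≡|q|²) c≢0 sim =
    similitude-descend k m c (q , c≡|q|²) c≢0
      (similitude-shrink (4 ℕ.* k ℕ.+ m) c q c≡|q|² c≢0 (subst (λ d → RationalSimilitude d c) dimension sim))
    where
    dimension : 4 ℕ.* ℕ.suc k ℕ.+ m ≡ 4 ℕ.+ (4 ℕ.* k ℕ.+ m)
    dimension = trans (cong (ℕ._+ m) (ℕ.*-suc 4 k)) (ℕ.+-assoc 4 (4 ℕ.* k) m)

  RationalSumOfTwoSquares : ℤ → Set
  RationalSumOfTwoSquares c = ∃[ X ] ∃[ Y ] ∃[ D ] D ≢ 0ℤ × X * X + Y * Y ≡ c * (D * D)

  similitude₂⇒rational-two-squares : ∀ c → RationalSimilitude 2 c → RationalSumOfTwoSquares c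
  similitude₂⇒rational-two-squares c (S , S≢0 , L , gram G) =
    X , Y , S , S≢0 , trans (cong (_+_ (X * X)) (sym (+-identityʳ (Y * Y)))) (trans (G e₀) (evaluate (c * (S * S))))
    where
    e₀ : Vector ℤ 2
    e₀ = 1ℤ ∷ 0ℤ ∷ []
    X = L zero · e₀
    Y = L (suc zero) · e₀
    evaluate : ∀ W → W * (1ℤ * 1ℤ) + (W * (0ℤ * 0ℤ) + 0ℤ) ≡ W
    evaluate = solve-∀

  -- The Davenport–Cassels descent for x² + y²

  ∣⊖∣≤ : ∀ ρ D → ρ ℕ.< 2 ℕ.* D → ∣ ρ ⊖ D ∣ ℕ.≤ D
  ∣⊖∣≤ ρ D ρ<2D with ρ ℕ.≤? D
  ... | yes ρ≤D = ℕ.≤-trans (ℕ.≤-reflexive (∣⊖∣-≤ ρ≤D)) (ℕ.m∸n≤m D ρ)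
  ... | no ρ≰D = ℕ.≤-trans (ℕ.≤-reflexive (trans (∣m⊖n∣≡∣n⊖m∣ ρ D) (∣⊖∣-≤ D≤ρ)))
                           (ℕ.m≤n+o⇒m∸n≤o ρ D (ℕ.<⇒≤ (subst (ρ ℕ.<_) (cong (D ℕ.+_) (ℕ.+-identityʳ D)) ρ<2D)))
    where
    D≤ρ = ℕ.<⇒≤ (ℕ.≰⇒> ρ≰D)

  -- y = ⌊(2X + D) / 2D⌋ is an integer nearest to X / D.
  nearest-multiple : ∀ X D .{{_ : ℕ.NonZero D}} → ∃[ y ] 2 ℕ.* ∣ X - + D * y ∣ ℕ.≤ D
  nearest-multiple X D@(ℕ.suc _) = y , ℕ.≤-trans (ℕ.≤-reflexive twice-error) (∣⊖∣≤ ρ D (n%ℕd<d N (2 ℕ.* D)))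
    where
    N = + 2 * X + + D
    y = N /ℕ (2 ℕ.* D)
    ρ = N %ℕ (2 ℕ.* D)
    expand : ∀ X D y → + 2 * (X - D * y) ≡ (+ 2 * X + D) - D - y * (+ 2 * D)
    expand = solve-∀
    collapse : ∀ ρ D y → ρ + y * (+ 2 * D) - D - y * (+ 2 * D) ≡ ρ - D
    collapse = solve-∀
    twice-error : 2 ℕ.* ∣ X - + D * y ∣ ≡ ∣ ρ ⊖ D ∣
    twice-error = begin
      2 ℕ.* ∣ X - + D * y ∣
        ≡⟨ abs-* (+ 2) (X - + D * y) ⟨
      ∣ + 2 * (X - + D * y) ∣
        ≡⟨ cong ∣_∣ (expand X (+ D) y) ⟩
      ∣ N - + D - y * (+ 2 * + D) ∣
        ≡⟨ cong (λ n → ∣ n - + D - y * (+ 2 * + D) ∣) (a≡a%ℕn+[a/ℕn]*n N (2 ℕ.* D)) ⟩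
      ∣ + ρ + y * + (2 ℕ.* D) - + D - y * (+ 2 * + D) ∣
        ≡⟨ cong (λ n → ∣ + ρ + y * n - + D - y * (+ 2 * + D) ∣) (pos-* 2 D) ⟩
      ∣ + ρ + y * (+ 2 * + D) - + D - y * (+ 2 * + D) ∣
        ≡⟨ cong ∣_∣ (trans (collapse (+ ρ) (+ D) y) (m-n≡m⊖n ρ D)) ⟩
      ∣ ρ ⊖ D ∣ ∎

  square-abs : ∀ e → e * e ≡ + (∣ e ∣ ℕ.* ∣ e ∣)
  square-abs (+ n)    = sym (pos-* n n)
  square-abs -[1+ n ] = refl

  square≡0 : ∀ e → ∣ e ∣ ℕ.* ∣ e ∣ ≡ 0 → e ≡ 0ℤ
  square≡0 e ∣e∣²≡0 with ℕ.m*n≡0⇒m≡0∨n≡0 ∣ e ∣ ∣e∣²≡0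
  ... | inj₁ ∣e∣≡0 = ∣i∣≡0⇒i≡0 ∣e∣≡0
  ... | inj₂ ∣e∣≡0 = ∣i∣≡0⇒i≡0 ∣e∣≡0

  quadruple-square-≤ : ∀ a D → 2 ℕ.* a ℕ.≤ D → 4 ℕ.* (a ℕ.* a) ℕ.≤ D ℕ.* D
  quadruple-square-≤ a D 2a≤D = subst (ℕ._≤ D ℕ.* D) (quadruple a) (ℕ.*-mono-≤ 2a≤D 2a≤D)
    where
    quadruple : ∀ a → 2 ℕ.* a ℕ.* (2 ℕ.* a) ≡ 4 ℕ.* (a ℕ.* a)
    quadruple = ℕ-solve-∀

  nonneg-quotient : ∀ d r s → +[1+ d ] * r ≡ + s → ∃[ r′ ] r ≡ + r′ × ℕ.suc d ℕ.* r′ ≡ s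
  nonneg-quotient d (+ r′) s D·r≡s = r′ , refl , +-injective (trans (pos-* (ℕ.suc d) r′) D·r≡s)

  quotient-bound : ∀ d D′ q → +[1+ d ] * D′ ≡ +[1+ q ] → ℕ.suc q ℕ.< ℕ.suc d ℕ.* ℕ.suc d →
    ∃[ d′ ] D′ ≡ +[1+ d′ ] × d′ ℕ.< d
  quotient-bound d (+ 0) q D·0≡q _ with () ← trans (sym (*-zeroʳ +[1+ d ])) D·0≡q
  quotient-bound d +[1+ d′ ] q D·D′≡q q<D² =
    d′ , refl , ℕ.s<s⁻¹ (ℕ.*-cancelˡ-< (ℕ.suc d) _ _ (subst (ℕ._< ℕ.suc d ℕ.* ℕ.suc d) (sym D·D′≡1+q) q<D²))
    where
    D·D′≡1+q : ℕ.suc d ℕ.* ℕ.suc d′ ≡ ℕ.suc q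
    D·D′≡1+q = +-injective (trans (pos-* (ℕ.suc d) (ℕ.suc d′)) D·D′≡q)

  -- The line through the rational point (X, Y) / D of the circle x² + y² = c and a nearest lattice
  -- point (y₁, y₂) meets the circle again at (X′, Y′) / D′, where D D′ = (X - D y₁)² + (Y - D y₂)².
  second-intersection-denominator : ∀ c X Y D y₁ y₂ → X * X + Y * Y ≡ c * (D * D) →
    D * (c * D - + 2 * (X * y₁ + Y * y₂) + D * (y₁ * y₁ + y₂ * y₂))
      ≡ (X - D * y₁) * (X - D * y₁) + (Y - D * y₂) * (Y - D * y₂)
  second-intersection-denominator c X Y D y₁ y₂ on-circle =
    ∙-cancelʳ (c * (D * D)) _ _ (trans (cong (_+_ (D * _)) (sym on-circle)) (identity c X Y D y₁ y₂))
    where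
    identity : ∀ c X Y D y₁ y₂ →
      D * (c * D - + 2 * (X * y₁ + Y * y₂) + D * (y₁ * y₁ + y₂ * y₂)) + (X * X + Y * Y)
        ≡ (X - D * y₁) * (X - D * y₁) + (Y - D * y₂) * (Y - D * y₂) + c * (D * D)
    identity = solve-∀

  second-intersection-on-circle : ∀ c X Y D y₁ y₂ → X * X + Y * Y ≡ c * (D * D) →
    let D′ = c * D - + 2 * (X * y₁ + Y * y₂) + D * (y₁ * y₁ + y₂ * y₂)
        k = y₁ * y₁ + y₂ * y₂ - c
        X′ = D′ * y₁ + k * (X - D * y₁)
        Y′ = D′ * y₂ + k * (Y - D * y₂)
    in X′ * X′ + Y′ * Y′ ≡ c * (D′ * D′)
  second-intersection-on-circle c X Y D y₁ y₂ on-circle =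
    ∙-cancelʳ (k * k * (c * (D * D))) _ _
      (trans (identity c X Y D y₁ y₂) (cong (λ s → c * (D′ * D′) + k * k * s) on-circle))
    where
    D′ = c * D - + 2 * (X * y₁ + Y * y₂) + D * (y₁ * y₁ + y₂ * y₂)
    k = y₁ * y₁ + y₂ * y₂ - c
    identity : ∀ c X Y D y₁ y₂ →
      let D′ = c * D - + 2 * (X * y₁ + Y * y₂) + D * (y₁ * y₁ + y₂ * y₂)
          k = y₁ * y₁ + y₂ * y₂ - c
          X′ = D′ * y₁ + k * (X - D * y₁)
          Y′ = D′ * y₂ + k * (Y - D * y₂)
      in X′ * X′ + Y′ * Y′ + k * k * (c * (D * D)) ≡ c * (D′ * D′) + k * k * (X * X + Y * Y)
    identity = solve-∀

  sum-squares-abs : ∀ e₁ e₂ → e₁ * e₁ + e₂ * e₂ ≡ + (∣ e₁ ∣ ℕ.* ∣ e₁ ∣ ℕ.+ ∣ e₂ ∣ ℕ.* ∣ e₂ ∣)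
  sum-squares-abs e₁ e₂ =
    trans (cong₂ _+_ (square-abs e₁) (square-abs e₂)) (sym (pos-+ (∣ e₁ ∣ ℕ.* ∣ e₁ ∣) (∣ e₂ ∣ ℕ.* ∣ e₂ ∣)))

  squares-sum-zero : ∀ e₁ e₂ → e₁ * e₁ + e₂ * e₂ ≡ 0ℤ → e₁ ≡ 0ℤ × e₂ ≡ 0ℤ
  squares-sum-zero e₁ e₂ sum≡0 = square≡0 e₁ (ℕ.m+n≡0⇒m≡0 _ q≡0) , square≡0 e₂ (ℕ.m+n≡0⇒n≡0 _ q≡0)
    where
    q≡0 = +-injective (trans (sym (sum-squares-abs e₁ e₂)) sum≡0)

  pair-bound : ∀ a b m → 2 ℕ.* a ℕ.≤ m → 2 ℕ.* b ℕ.≤ m →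
    4 ℕ.* (a ℕ.* a ℕ.+ b ℕ.* b) ℕ.≤ m ℕ.* m ℕ.+ m ℕ.* m
  pair-bound a b m 2a≤m 2b≤m = ℕ.≤-trans (ℕ.≤-reflexive (ℕ.*-distribˡ-+ 4 (a ℕ.* a) (b ℕ.* b)))
                                         (ℕ.+-mono-≤ (quadruple-square-≤ a m 2a≤m) (quadruple-square-≤ b m 2b≤m))

  small-errors : ∀ e₁ e₂ D → 2 ℕ.* ∣ e₁ ∣ ℕ.≤ ℕ.suc D → 2 ℕ.* ∣ e₂ ∣ ℕ.≤ ℕ.suc D →
    ∃[ q ] e₁ * e₁ + e₂ * e₂ ≡ + q × q ℕ.< ℕ.suc D ℕ.* ℕ.suc D
  small-errors e₁ e₂ D b₁ b₂ =
    _ , sum-squares-abs e₁ e₂ ,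
    ℕ.*-cancelˡ-< 4 _ _ (ℕ.≤-<-trans (pair-bound ∣ e₁ ∣ ∣ e₂ ∣ (ℕ.suc D) b₁ b₂) (half _))
    where
    half : ∀ n → ℕ.suc n ℕ.+ ℕ.suc n ℕ.< 4 ℕ.* ℕ.suc n
    half n = ℕ.+-monoʳ-< (ℕ.suc n) (ℕ.m<m+n (ℕ.suc n) ℕ.z<s)

  -- A rational point (X / (d + 1), Y / (d + 1)) on the circle x² + y² = c.
  CirclePoint : ℤ → ℕ → Set
  CirclePoint c d = ∃[ X ] ∃[ Y ] X * X + Y * Y ≡ c * (+[1+ d ] * +[1+ d ])

  lattice-point-on-circle : ∀ c X Y d y₁ y₂ → X * X + Y * Y ≡ c * (+[1+ d ] * +[1+ d ]) →
    X - +[1+ d ] * y₁ ≡ 0ℤ → Y - +[1+ d ] * y₂ ≡ 0ℤ → c ≡ y₁ * y₁ + y₂ * y₂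
  lattice-point-on-circle c X Y d y₁ y₂ on-circle e₁≡0 e₂≡0 = *-cancelˡ-≡ (D * D) c (y₁ * y₁ + y₂ * y₂) (begin
    D * D * c                                  ≡⟨ *-comm (D * D) c ⟩
    c * (D * D)                                ≡⟨ on-circle ⟨
    X * X + Y * Y                              ≡⟨ cong₂ (λ x y → x * x + y * y) (i-j≡0⇒i≡j X (D * y₁) e₁≡0)
                                                                            (i-j≡0⇒i≡j Y (D * y₂) e₂≡0) ⟩
    (D * y₁) * (D * y₁) + (D * y₂) * (D * y₂)  ≡⟨ factor D y₁ y₂ ⟩
    D * D * (y₁ * y₁ + y₂ * y₂)                ∎)
    where
    D = +[1+ d ]
    factor : ∀ D y₁ y₂ → (D * y₁) * (D * y₁) + (D * y₂) * (D * y₂) ≡ D * D * (y₁ * y₁ + y₂ * y₂)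
    factor = solve-∀

  circle-descent-step : ∀ c X Y d → X * X + Y * Y ≡ c * (+[1+ d ] * +[1+ d ]) →
    SumOfTwoSquares c ⊎ ∃[ d′ ] d′ ℕ.< d × CirclePoint c d′
  circle-descent-step c X Y d on-circle = through (nearest-multiple X (ℕ.suc d)) (nearest-multiple Y (ℕ.suc d))
    where
    D = +[1+ d ]
    through : ∃[ y₁ ] 2 ℕ.* ∣ X - D * y₁ ∣ ℕ.≤ ℕ.suc d → ∃[ y₂ ] 2 ℕ.* ∣ Y - D * y₂ ∣ ℕ.≤ ℕ.suc d →
      SumOfTwoSquares c ⊎ ∃[ d′ ] d′ ℕ.< d × CirclePoint c d′
    through (y₁ , b₁) (y₂ , b₂) = conclude (small-errors (X - D * y₁) (Y - D * y₂) d b₁ b₂)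
      where
      D′ = c * D - + 2 * (X * y₁ + Y * y₂) + D * (y₁ * y₁ + y₂ * y₂)
      k = y₁ * y₁ + y₂ * y₂ - c
      X′ = D′ * y₁ + k * (X - D * y₁)
      Y′ = D′ * y₂ + k * (Y - D * y₂)
      conclude : ∃[ q ] (X - D * y₁) * (X - D * y₁) + (Y - D * y₂) * (Y - D * y₂) ≡ + q × q ℕ.< ℕ.suc d ℕ.* ℕ.suc d →
        SumOfTwoSquares c ⊎ ∃[ d′ ] d′ ℕ.< d × CirclePoint c d′
      conclude (0 , Q≡0 , _) =
        let e₁≡0 , e₂≡0 = squares-sum-zero _ _ Q≡0
        in inj₁ (y₁ , y₂ , lattice-point-on-circle c X Y d y₁ y₂ on-circle e₁≡0 e₂≡0)
      conclude (ℕ.suc q , Q≡q , q<D²) =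
        let d′ , D′≡d′ , d′<d =
              quotient-bound d D′ q (trans (second-intersection-denominator c X Y D y₁ y₂ on-circle) Q≡q) q<D²
        in inj₂ (d′ , d′<d , X′ , Y′ ,
                 subst (λ u → X′ * X′ + Y′ * Y′ ≡ c * (u * u)) D′≡d′ (second-intersection-on-circle c X Y D y₁ y₂ on-circle))

  circle-descent : ∀ c d → CirclePoint c d → SumOfTwoSquares c
  circle-descent c = <-rec (λ d → CirclePoint c d → SumOfTwoSquares c) descend
    where
    descend : ∀ d → (∀ {d′} → d′ ℕ.< d → CirclePoint c d′ → SumOfTwoSquares c) → CirclePoint c d → SumOfTwoSquares c
    descend d smaller (X , Y , on-circle) = [ id , continue ] (circle-descent-step c X Y d on-circle)
      where
      continue : ∃[ d′ ] d′ ℕ.< d × CirclePoint c d′ → SumOfTwoSquares c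
      continue (d′ , d′<d , point) = smaller d′<d point

  davenport-cassels : ∀ c → RationalSumOfTwoSquares c → SumOfTwoSquares c
  davenport-cassels c (X , Y , D , D≢0 , on-circle) = from-abs ∣ D ∣ refl
    where
    from-abs : ∀ n → ∣ D ∣ ≡ n → SumOfTwoSquares c
    from-abs 0 ∣D∣≡0 = contradiction (∣i∣≡0⇒i≡0 ∣D∣≡0) D≢0
    from-abs (ℕ.suc d) ∣D∣≡1+d =
      circle-descent c d (X , Y , trans on-circle (cong (c *_) (begin
        D * D                       ≡⟨ square-abs D ⟩
        + (∣ D ∣ ℕ.* ∣ D ∣)         ≡⟨ cong (λ n → + (n ℕ.* n)) ∣D∣≡1+d ⟩
        + (ℕ.suc d ℕ.* ℕ.suc d)     ≡⟨ pos-* (ℕ.suc d) (ℕ.suc d) ⟩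
        +[1+ d ] * +[1+ d ]         ∎)))

  -- Lagrange's four-square theorem

  residue : ℤ → ℍ → ℍ → ℍ
  residue M (quat a b c d) (quat e f g h) = quat (a - M * e) (b - M * f) (c - M * g) (d - M * h)

  infixl 6 _+ᵣ_
  _+ᵣ_ : ℍ → ℤ → ℍ
  quat a b c d +ᵣ r = quat (a + r) b c d

  norm-residue : ∀ M x z → norm x ≡ M * (M * norm z + + 2 * ⟨ z , residue M x z ⟩) + norm (residue M x z)
  norm-residue M (quat a b c d) (quat e f g h) = expand M a b c d e f g h
    where
    expand : ∀ M a b c d e f g h →
      let y₀ = a - M * e
          y₁ = b - M * f
          y₂ = c - M * g
          y₃ = d - M * h
      in (a * a + b * b) + (c * c + d * d)
         ≡ M * (M * ((e * e + f * f) + (g * g + h * h)) + + 2 * (e * y₀ + f * y₁ + g * y₂ + h * y₃))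
           + ((y₀ * y₀ + y₁ * y₁) + (y₂ * y₂ + y₃ * y₃))
    expand = solve-∀

  residue-quotient : ∀ M P x z → norm x ≡ M * P →
    norm (residue M x z) ≡ M * (P - M * norm z - + 2 * ⟨ z , residue M x z ⟩)
  residue-quotient M P x z norm-x =
    ∙-cancelˡ (M * (M * norm z + + 2 * ⟨ z , y ⟩)) _ _
      (trans (sym (norm-residue M x z)) (trans norm-x (split M P (norm z) ⟨ z , y ⟩)))
    where
    y = residue M x z
    split : ∀ M P A B → M * P ≡ M * (M * A + + 2 * B) + M * (P - M * A - + 2 * B)
    split = solve-∀

  -- With y = residue M x z, u = z ⋆ conj y +ᵣ r and δ = |y|² - M r one has x ⋆ conj y = M u + δ,
  -- so this is |x ⋆ conj y|² = |x|² |y|².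
  conj-residue-identity : ∀ M r x z →
    let y = residue M x z
        u = z ⋆ conj y +ᵣ r
        δ = norm y - M * r
    in M * (M * norm u) + δ * (+ 2 * M * ℍ.re u + δ) ≡ norm x * norm y
  conj-residue-identity M r (quat a b c d) (quat e f g h) = identity M r a b c d e f g h
    where
    identity : ∀ M r a b c d e f g h →
      let y₀ = a - M * e
          y₁ = b - M * f
          y₂ = c - M * g
          y₃ = d - M * h
          u₀ = e * y₀ - f * - y₁ - g * - y₂ - h * - y₃ + r
          u₁ = e * - y₁ + f * y₀ + g * - y₃ - h * - y₂
          u₂ = e * - y₂ - f * - y₃ + g * y₀ + h * - y₁
          u₃ = e * - y₃ + f * - y₂ - g * - y₁ + h * y₀
          δ = (y₀ * y₀ + y₁ * y₁) + (y₂ * y₂ + y₃ * y₃) - M * r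
      in M * (M * ((u₀ * u₀ + u₁ * u₁) + (u₂ * u₂ + u₃ * u₃))) + δ * (+ 2 * M * u₀ + δ)
         ≡ ((a * a + b * b) + (c * c + d * d)) * ((y₀ * y₀ + y₁ * y₁) + (y₂ * y₂ + y₃ * y₃))
    identity = solve-∀

  norm-descent : ∀ M P r x z → M ≢ 0ℤ → norm x ≡ M * P → norm (residue M x z) ≡ M * r →
    norm (z ⋆ conj (residue M x z) +ᵣ r) ≡ r * P
  norm-descent M P r x z M≢0 norm-x norm-y =
    *-cancelˡ-≡ M _ _ {{≢-nonZero M≢0}} (*-cancelˡ-≡ M _ _ {{≢-nonZero M≢0}} (begin
      M * (M * norm u)                           ≡⟨ +-identityʳ _ ⟨
      M * (M * norm u) + 0ℤ * (+ 2 * M * ℍ.re u + 0ℤ)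
        ≡⟨ cong (λ δ → M * (M * norm u) + δ * (+ 2 * M * ℍ.re u + δ)) δ≡0 ⟨
      M * (M * norm u) + δ * (+ 2 * M * ℍ.re u + δ) ≡⟨ conj-residue-identity M r x z ⟩
      norm x * norm y                            ≡⟨ cong₂ _*_ norm-x norm-y ⟩
      M * P * (M * r)                            ≡⟨ regroup M P r ⟩
      M * (M * (r * P))                          ∎))
    where
    y = residue M x z
    u = z ⋆ conj y +ᵣ r
    δ = norm y - M * r
    δ≡0 : δ ≡ 0ℤ
    δ≡0 = trans (cong (_- M * r) norm-y) (+-inverseʳ (M * r))
    regroup : ∀ M P r → M * P * (M * r) ≡ M * (M * (r * P))
    regroup = solve-∀

  double : ℍ → ℍ
  double (quat a b c d) = quat (+ 2 * a) (+ 2 * b) (+ 2 * c) (+ 2 * d)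

  ⟨,double⟩ : ∀ z y → ⟨ z , double y ⟩ ≡ + 2 * ⟨ z , y ⟩
  ⟨,double⟩ (quat e f g h) (quat a b c d) = regroup e f g h a b c d
    where
    regroup : ∀ e f g h a b c d →
      e * (+ 2 * a) + f * (+ 2 * b) + g * (+ 2 * c) + h * (+ 2 * d) ≡ + 2 * (e * a + f * b + g * c + h * d)
    regroup = solve-∀

  infix 4 _∣ℍ_
  _∣ℍ_ : ℤ → ℍ → Set
  M ∣ℍ quat a b c d = (M ∣ a) × (M ∣ b) × (M ∣ c) × (M ∣ d)

  ∣ℍ⇒∣⟨,⟩ : ∀ M z q → M ∣ℍ q → M ∣ ⟨ z , q ⟩
  ∣ℍ⇒∣⟨,⟩ M (quat e f g h) (quat a b c d) (M∣a , M∣b , M∣c , M∣d) =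
    ∣m∣n⇒∣m+n (∣m∣n⇒∣m+n (∣m∣n⇒∣m+n (∣n⇒∣m*n e M∣a) (∣n⇒∣m*n f M∣b)) (∣n⇒∣m*n g M∣c))
              (∣n⇒∣m*n h M∣d)

  residue-divides : ∀ M P z y → M ∣ℍ double y → M ∣ P - M * norm z - + 2 * ⟨ z , y ⟩ → M ∣ P
  residue-divides M P z y M∣2y M∣r =
    subst (M ∣_) (sym P≡)
      (∣m∣n⇒∣m+n (∣m∣n⇒∣m+n (∣m⇒∣m*n (norm z) ∣-refl) (∣ℍ⇒∣⟨,⟩ M z (double y) M∣2y)) M∣r)
    where
    recompose : ∀ M P A B → P ≡ M * A + + 2 * B + (P - M * A - + 2 * B)
    recompose = solve-∀
    P≡ : P ≡ M * norm z + ⟨ z , double y ⟩ + (P - M * norm z - + 2 * ⟨ z , y ⟩)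
    P≡ = trans (recompose M P (norm z) ⟨ z , y ⟩)
               (cong (λ t → M * norm z + t + (P - M * norm z - + 2 * ⟨ z , y ⟩)) (sym (⟨,double⟩ z y)))

  divides-zero : ∀ {M} y → y ≡ 0ℤ → M ∣ + 2 * y
  divides-zero _ refl = divides 0ℤ refl

  divides-double : ∀ m y → 2 ℕ.* ∣ y ∣ ≡ m → + m ∣ + 2 * y
  divides-double m y 2∣y∣≡m = ∣ᵤ⇒∣ (ℕ.∣-reflexive (sym (trans (abs-* (+ 2) y) 2∣y∣≡m)))

  +-saturated : ∀ {x y M N} → x ℕ.≤ M → y ℕ.≤ N → x ℕ.+ y ≡ M ℕ.+ N → x ≡ M × y ≡ N
  +-saturated {x} {y} {M} {N} x≤M y≤N x+y≡M+N = x≡M , ℕ.+-cancelˡ-≡ M y N (trans (cong (ℕ._+ y) (sym x≡M)) x+y≡M+N)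
    where
    M≤x : M ℕ.≤ x
    M≤x = ℕ.+-cancelʳ-≤ N M x (subst (ℕ._≤ x ℕ.+ N) x+y≡M+N (ℕ.+-monoʳ-≤ x y≤N))
    x≡M = ℕ.≤-antisym x≤M M≤x

  square-injective : ∀ a b → a ℕ.* a ≡ b ℕ.* b → a ≡ b
  square-injective a b a²≡b² with ℕ.<-cmp a b
  ... | tri< a<b _ _ = contradiction a²≡b² (ℕ.<⇒≢ (ℕ.*-mono-< a<b a<b))
  ... | tri≈ _ a≡b _ = a≡b
  ... | tri> _ _ b<a = contradiction (sym a²≡b²) (ℕ.<⇒≢ (ℕ.*-mono-< b<a b<a))

  pair-saturated : ∀ a b m → 2 ℕ.* a ℕ.≤ m → 2 ℕ.* b ℕ.≤ m →
    4 ℕ.* (a ℕ.* a ℕ.+ b ℕ.* b) ≡ m ℕ.* m ℕ.+ m ℕ.* m → 2 ℕ.* a ≡ m × 2 ℕ.* b ≡ m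
  pair-saturated a b m 2a≤m 2b≤m saturated =
    let 4a²≡m² , 4b²≡m² = +-saturated (quadruple-square-≤ a m 2a≤m) (quadruple-square-≤ b m 2b≤m)
                            (trans (sym (ℕ.*-distribˡ-+ 4 (a ℕ.* a) (b ℕ.* b))) saturated)
    in square-injective _ m (trans (quadruple a) 4a²≡m²) , square-injective _ m (trans (quadruple b) 4b²≡m²)
    where
    quadruple : ∀ a → 2 ℕ.* a ℕ.* (2 ℕ.* a) ≡ 4 ℕ.* (a ℕ.* a)
    quadruple = ℕ-solve-∀

  SmallResidue : ℕ → ℍ → Set
  SmallResidue m (quat a b c d) =
    2 ℕ.* ∣ a ∣ ℕ.≤ m × 2 ℕ.* ∣ b ∣ ℕ.≤ m × 2 ℕ.* ∣ c ∣ ℕ.≤ m × 2 ℕ.* ∣ d ∣ ℕ.≤ m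

  nearest-quaternion : ∀ x m .{{_ : ℕ.NonZero m}} → ∃[ z ] SmallResidue m (residue (+ m) x z)
  nearest-quaternion (quat a b c d) m =
    let z₀ , b₀ = nearest-multiple a m
        z₁ , b₁ = nearest-multiple b m
        z₂ , b₂ = nearest-multiple c m
        z₃ , b₃ = nearest-multiple d m
    in quat z₀ z₁ z₂ z₃ , b₀ , b₁ , b₂ , b₃

  -- At the extremes |y|² = 0 and |y|² = m² every coordinate of y is 0, resp. ± m / 2.
  small-residue-norm : ∀ m y → SmallResidue m y →
    ∃[ s ] norm y ≡ + s × s ℕ.≤ m ℕ.* m × (s ≡ 0 ⊎ s ≡ m ℕ.* m → + m ∣ℍ double y)
  small-residue-norm m (quat a b c d) (b₀ , b₁ , b₂ , b₃) = A ℕ.+ B , norm≡ , s≤m² , extremes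
    where
    A = ∣ a ∣ ℕ.* ∣ a ∣ ℕ.+ ∣ b ∣ ℕ.* ∣ b ∣
    B = ∣ c ∣ ℕ.* ∣ c ∣ ℕ.+ ∣ d ∣ ℕ.* ∣ d ∣
    norm≡ = trans (cong₂ _+_ (sum-squares-abs a b) (sum-squares-abs c d)) (sym (pos-+ A B))
    4A≤ = pair-bound ∣ a ∣ ∣ b ∣ m b₀ b₁
    4B≤ = pair-bound ∣ c ∣ ∣ d ∣ m b₂ b₃
    four : ∀ n → 4 ℕ.* n ≡ n ℕ.+ n ℕ.+ (n ℕ.+ n)
    four = ℕ-solve-∀
    s≤m² : A ℕ.+ B ℕ.≤ m ℕ.* m
    s≤m² = ℕ.*-cancelˡ-≤ 4 (ℕ.≤-trans (ℕ.≤-reflexive (ℕ.*-distribˡ-+ 4 A B))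
                                      (ℕ.≤-trans (ℕ.+-mono-≤ 4A≤ 4B≤) (ℕ.≤-reflexive (sym (four (m ℕ.* m))))))
    extremes : A ℕ.+ B ≡ 0 ⊎ A ℕ.+ B ≡ m ℕ.* m → + m ∣ℍ double (quat a b c d)
    extremes (inj₁ s≡0) =
      let a≡0 , b≡0 = squares-sum-zero a b (trans (sum-squares-abs a b) (cong +_ (ℕ.m+n≡0⇒m≡0 A s≡0)))
          c≡0 , d≡0 = squares-sum-zero c d (trans (sum-squares-abs c d) (cong +_ (ℕ.m+n≡0⇒n≡0 A s≡0)))
      in divides-zero a a≡0 , divides-zero b b≡0 , divides-zero c c≡0 , divides-zero d d≡0
    extremes (inj₂ s≡m²) =
      let 4A≡ , 4B≡ = +-saturated 4A≤ 4B≤ (trans (sym (ℕ.*-distribˡ-+ 4 A B)) (trans (cong (4 ℕ.*_) s≡m²) (four (m ℕ.* m))))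
          2a≡m , 2b≡m = pair-saturated ∣ a ∣ ∣ b ∣ m b₀ b₁ 4A≡
          2c≡m , 2d≡m = pair-saturated ∣ c ∣ ∣ d ∣ m b₂ b₃ 4B≡
      in divides-double m a 2a≡m , divides-double m b 2b≡m , divides-double m c 2c≡m , divides-double m d 2d≡m

  -- Writing x = m z + y with y small gives |y|² = m r with 0 ≤ r ≤ m and |z ⋆ conj y +ᵣ r|² = r p;
  -- the extreme cases r = 0 and r = m would force m ∣ p.
  euler-step : ∀ {p} k → Prime p → 2 ℕ.+ k ℕ.< p → ∀ x z → SmallResidue (2 ℕ.+ k) (residue (+ (2 ℕ.+ k)) x z) →
    norm x ≡ + (2 ℕ.+ k) * + p → ∃[ r ] r ℕ.< ℕ.suc k × SumOfFourSquares (+[1+ r ] * + p)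
  euler-step {p} k p-prime m<p x z small norm-x = classify (small-residue-norm m y small)
    where
    m = 2 ℕ.+ k
    M = + m
    y = residue M x z
    r = + p - M * norm z - + 2 * ⟨ z , y ⟩
    norm-y : norm y ≡ M * r
    norm-y = residue-quotient M (+ p) x z norm-x
    impossible : M ∣ℍ double y → M ∣ r → ⊥
    impossible M∣2y M∣r = prime⇒¬composite p-prime (composite m<p (∣⇒∣ᵤ (residue-divides M (+ p) z y M∣2y M∣r)))
    classify : ∃[ s ] norm y ≡ + s × s ℕ.≤ m ℕ.* m × (s ≡ 0 ⊎ s ≡ m ℕ.* m → M ∣ℍ double y) →
      ∃[ r ] r ℕ.< ℕ.suc k × SumOfFourSquares (+[1+ r ] * + p)
    classify (s , norm-y≡s , s≤m² , extreme) = by-size (nonneg-quotient (ℕ.suc k) r s (trans (sym norm-y) norm-y≡s))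
      where
      by-size : ∃[ r′ ] r ≡ + r′ × m ℕ.* r′ ≡ s → ∃[ r ] r ℕ.< ℕ.suc k × SumOfFourSquares (+[1+ r ] * + p)
      by-size (0 , r≡0 , m·0≡s) =
        ⊥-elim (impossible (extreme (inj₁ (trans (sym m·0≡s) (ℕ.*-zeroʳ m)))) (subst (M ∣_) (sym r≡0) (divides 0ℤ refl)))
      by-size (ℕ.suc r₀ , r≡r′ , m·r′≡s) = compare-with-m (ℕ.suc r₀ ℕ.≟ m)
        where
        compare-with-m : Dec (ℕ.suc r₀ ≡ m) → ∃[ r ] r ℕ.< ℕ.suc k × SumOfFourSquares (+[1+ r ] * + p)
        compare-with-m (yes r′≡m) =
          ⊥-elim (impossible (extreme (inj₂ (trans (sym m·r′≡s) (cong (m ℕ.*_) r′≡m))))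
                             (subst (M ∣_) (sym (trans r≡r′ (cong +_ r′≡m))) ∣-refl))
        compare-with-m (no r′≢m) =
          r₀ , ℕ.s<s⁻¹ (ℕ.≤∧≢⇒< r′≤m r′≢m) , z ⋆ conj y +ᵣ r ,
          sym (trans (norm-descent M (+ p) r x z (λ ()) norm-x norm-y) (cong (_* + p) r≡r′))
          where
          r′≤m = ℕ.*-cancelˡ-≤ m (ℕ.≤-trans (ℕ.≤-reflexive m·r′≡s) s≤m²)

  euler-descent : ∀ {p} → Prime p → ∀ j → ℕ.suc j ℕ.< p → SumOfFourSquares (+[1+ j ] * + p) → SumOfFourSquares (+ p)
  euler-descent {p} p-prime = <-rec (λ j → ℕ.suc j ℕ.< p → SumOfFourSquares (+[1+ j ] * + p) → SumOfFourSquares (+ p)) descend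
    where
    descend : ∀ j → (∀ {j′} → j′ ℕ.< j → ℕ.suc j′ ℕ.< p → SumOfFourSquares (+[1+ j′ ] * + p) → SumOfFourSquares (+ p)) →
      ℕ.suc j ℕ.< p → SumOfFourSquares (+[1+ j ] * + p) → SumOfFourSquares (+ p)
    descend 0 _ _ (x , p≡|x|²) = x , trans (sym (*-identityˡ (+ p))) p≡|x|²
    descend (ℕ.suc k) smaller m<p (x , mp≡|x|²) = reduce (nearest-quaternion x (2 ℕ.+ k))
      where
      continue : ∃[ r ] r ℕ.< ℕ.suc k × SumOfFourSquares (+[1+ r ] * + p) → SumOfFourSquares (+ p)
      continue (r , r<m , rp≡|u|²) = smaller r<m (ℕ.<-trans (ℕ.s<s r<m) m<p) rp≡|u|²
      reduce : ∃[ z ] SmallResidue (2 ℕ.+ k) (residue (+ (2 ℕ.+ k)) x z) → SumOfFourSquares (+ p)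
      reduce (z , small) = continue (euler-step k p-prime m<p x z small (sym mp≡|x|²))

  halve : ∀ n → ∃[ h ] (n ≡ h ℕ.+ h ⊎ n ≡ ℕ.suc (h ℕ.+ h))
  halve 0 = 0 , inj₁ refl
  halve (ℕ.suc n) with halve n
  ... | h , inj₁ n≡2h   = h , inj₂ (cong ℕ.suc n≡2h)
  ... | h , inj₂ n≡2h+1 = ℕ.suc h , inj₁ (cong ℕ.suc (trans n≡2h+1 (sym (ℕ.+-suc h h))))

  prime-cases : ∀ {p} → Prime p → p ≡ 2 ⊎ ∃[ h ] p ≡ ℕ.suc (ℕ.suc h ℕ.+ ℕ.suc h)
  prime-cases {p} p-prime with halve p
  ... | 0 , inj₁ refl = ⊥-elim (ℕ.≢-nonZero⁻¹ 0 {{prime⇒nonZero p-prime}} refl)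
  ... | 1 , inj₁ refl = inj₁ refl
  ... | ℕ.suc (ℕ.suc h) , inj₁ refl =
    ⊥-elim (prime⇒¬composite p-prime
             (composite (ℕ.s<s (ℕ.s<s (ℕ.<-≤-trans ℕ.z<s (ℕ.m≤n+m _ h))))
                        (ℕ.divides (ℕ.suc (ℕ.suc h)) (double-is-twice (ℕ.suc (ℕ.suc h))))))
    where
    double-is-twice : ∀ h → h ℕ.+ h ≡ h ℕ.* 2
    double-is-twice = ℕ-solve-∀
  ... | 0 , inj₂ refl = ⊥-elim (ℕ.nonTrivial⇒≢1 {{prime⇒nonTrivial p-prime}} refl)
  ... | ℕ.suc h , inj₂ refl = inj₂ (h , refl)

  no-small-multiple : ∀ {p n} → n ≢ 0 → n ℕ.< p → ¬ p ℕ.∣ n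
  no-small-multiple n≢0 n<p p∣n = ℕ.<⇒≱ n<p (ℕ.∣⇒≤ {{ℕ.≢-nonZero n≢0}} p∣n)

  -- p ∣ (i - j) (i + j) with both factors strictly between 0 and p.
  distinct-squares : ∀ {p} i j → Prime p → i ≢ j → i ℕ.+ j ℕ.< p → ¬ (+ p ∣ + (i ℕ.* i) - + (j ℕ.* j))
  distinct-squares {p} i j p-prime i≢j i+j<p p∣i²-j² with euclidsLemma ∣ i ⊖ j ∣ (i ℕ.+ j) p-prime p∣product
    where
    factor : ∀ a b → a * a - b * b ≡ (a - b) * (a + b)
    factor = solve-∀
    p∣product : p ℕ.∣ ∣ i ⊖ j ∣ ℕ.* (i ℕ.+ j)
    p∣product = subst (p ℕ.∣_) (trans (cong ∣_∣ (trans (cong₂ _-_ (pos-* i i) (pos-* j j)) (factor (+ i) (+ j))))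
                                      (trans (abs-* (+ i - + j) (+ i + + j))
                                             (cong₂ ℕ._*_ (cong ∣_∣ (m-n≡m⊖n i j)) (cong ∣_∣ (sym (pos-+ i j))))))
                               (∣⇒∣ᵤ p∣i²-j²)
  ... | inj₁ p∣i-j =
    no-small-multiple (i≢j ∘ ⊖≡0) (ℕ.≤-<-trans (ℕ.≤-trans (∣m⊝n∣≤m⊔n i j) (ℕ.m⊔n≤m+n i j)) i+j<p) p∣i-j
    where
    ⊖≡0 : ∣ i ⊖ j ∣ ≡ 0 → i ≡ j
    ⊖≡0 ∣i⊖j∣≡0 = +-injective (i-j≡0⇒i≡j (+ i) (+ j) (trans (m-n≡m⊖n i j) (∣i∣≡0⇒i≡0 ∣i⊖j∣≡0)))
  ... | inj₂ p∣i+j =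
    no-small-multiple (λ i+j≡0 → i≢j (trans (ℕ.m+n≡0⇒m≡0 i i+j≡0) (sym (ℕ.m+n≡0⇒n≡0 i i+j≡0)))) i+j<p p∣i+j

  %ℕ-≡⇒∣ : ∀ a b n .{{_ : ℕ.NonZero n}} → a %ℕ n ≡ b %ℕ n → + n ∣ a - b
  %ℕ-≡⇒∣ a b n same-remainder = divides (a /ℕ n - b /ℕ n) (begin
    a - b
      ≡⟨ cong₂ _-_ (a≡a%ℕn+[a/ℕn]*n a n) (a≡a%ℕn+[a/ℕn]*n b n) ⟩
    (+ (a %ℕ n) + a /ℕ n * + n) - (+ (b %ℕ n) + b /ℕ n * + n)
      ≡⟨ cong (λ ρ → (+ (a %ℕ n) + a /ℕ n * + n) - (+ ρ + b /ℕ n * + n)) same-remainder ⟨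
    (+ (a %ℕ n) + a /ℕ n * + n) - (+ (a %ℕ n) + b /ℕ n * + n)
      ≡⟨ cancel (+ (a %ℕ n)) (a /ℕ n) (b /ℕ n) (+ n) ⟩
    (a /ℕ n - b /ℕ n) * + n ∎)
    where
    cancel : ∀ ρ qa qb n → (ρ + qa * n) - (ρ + qb * n) ≡ (qa - qb) * n
    cancel = solve-∀

  MinusOneSumOfTwoSquares : ℕ → ℕ → Set
  MinusOneSumOfTwoSquares h p = ∃[ x ] ∃[ y ] x ℕ.≤ h × y ℕ.≤ h × + p ∣ + (x ℕ.* x ℕ.+ y ℕ.* y ℕ.+ 1)

  candidate : ∀ {h} → Fin (ℕ.suc h) ⊎ Fin (ℕ.suc h) → ℤ
  candidate (inj₁ i) = + (toℕ i ℕ.* toℕ i)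
  candidate (inj₂ j) = -1ℤ - + (toℕ j ℕ.* toℕ j)

  candidates-collide : ∀ h → Prime (ℕ.suc (h ℕ.+ h)) → ∀ c₁ c₂ → c₁ ≢ c₂ →
    + ℕ.suc (h ℕ.+ h) ∣ candidate c₁ - candidate c₂ → MinusOneSumOfTwoSquares h (ℕ.suc (h ℕ.+ h))
  candidates-collide h p-prime = collide
    where
    P = ℕ.suc (h ℕ.+ h)
    bound : (i : Fin (ℕ.suc h)) → toℕ i ℕ.≤ h
    bound i = ℕ.s≤s⁻¹ (toℕ<n i)
    sum-bound : (i j : Fin (ℕ.suc h)) → toℕ i ℕ.+ toℕ j ℕ.< P
    sum-bound i j = ℕ.s≤s (ℕ.+-mono-≤ (bound i) (bound j))
    shifted : ∀ a b → (-1ℤ - a) - (-1ℤ - b) ≡ b - a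
    shifted = solve-∀
    mixed : ∀ a b → a - (-1ℤ - b) ≡ a + b + 1ℤ
    mixed = solve-∀
    mixed′ : ∀ a b → (-1ℤ - b) - a ≡ - (a + b + 1ℤ)
    mixed′ = solve-∀
    as-ℕ : ∀ x y → + x + + y + 1ℤ ≡ + (x ℕ.+ y ℕ.+ 1)
    as-ℕ x y = sym (trans (pos-+ (x ℕ.+ y) 1) (cong (_+ 1ℤ) (pos-+ x y)))
    square : Fin (ℕ.suc h) → ℤ
    square i = + (toℕ i ℕ.* toℕ i)
    collide : ∀ c₁ c₂ → c₁ ≢ c₂ → + P ∣ candidate c₁ - candidate c₂ → MinusOneSumOfTwoSquares h P
    collide (inj₁ i) (inj₁ j) i≢j P∣ =
      ⊥-elim (distinct-squares (toℕ i) (toℕ j) p-prime (i≢j ∘ cong inj₁ ∘ toℕ-injective) (sum-bound i j) P∣)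
    collide (inj₂ i) (inj₂ j) i≢j P∣ =
      ⊥-elim (distinct-squares (toℕ j) (toℕ i) p-prime (i≢j ∘ cong inj₂ ∘ toℕ-injective ∘ sym) (sum-bound j i)
                (subst (+ P ∣_) (shifted (square i) (square j)) P∣))
    collide (inj₁ i) (inj₂ j) _ P∣ =
      toℕ i , toℕ j , bound i , bound j ,
      subst (+ P ∣_) (trans (mixed (square i) (square j)) (as-ℕ (toℕ i ℕ.* toℕ i) (toℕ j ℕ.* toℕ j))) P∣
    collide (inj₂ j) (inj₁ i) _ P∣ =
      toℕ i , toℕ j , bound i , bound j ,
      subst (+ P ∣_) (trans (neg-involutive _) (as-ℕ (toℕ i ℕ.* toℕ i) (toℕ j ℕ.* toℕ j)))
        (∣m⇒∣-m (subst (+ P ∣_) (mixed′ (square i) (square j)) P∣))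

  -- The 2h + 2 candidates x² and -1 - y² (x, y ≤ h) cannot be pairwise distinct modulo p = 2h + 1.
  minus-one-sum-of-two-squares : ∀ h → Prime (ℕ.suc (h ℕ.+ h)) → MinusOneSumOfTwoSquares h (ℕ.suc (h ℕ.+ h))
  minus-one-sum-of-two-squares h p-prime = from-collision (pigeonhole (ℕ.s<s (ℕ.+-monoʳ-< h (ℕ.n<1+n h))) class)
    where
    P = ℕ.suc (h ℕ.+ h)
    class : Fin (ℕ.suc h ℕ.+ ℕ.suc h) → Fin P
    class k = fromℕ< (n%ℕd<d (candidate (splitAt (ℕ.suc h) k)) P)
    from-collision : ∃[ k₁ ] ∃[ k₂ ] k₁ Fin.< k₂ × class k₁ ≡ class k₂ → MinusOneSumOfTwoSquares h P
    from-collision (k₁ , k₂ , k₁<k₂ , same-class) =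
      candidates-collide h p-prime c₁ c₂ distinct
        (%ℕ-≡⇒∣ (candidate c₁) (candidate c₂) P (trans (sym (toℕ-fromℕ< _)) (trans (cong toℕ same-class) (toℕ-fromℕ< _))))
      where
      c₁ = splitAt (ℕ.suc h) k₁
      c₂ = splitAt (ℕ.suc h) k₂
      distinct : c₁ ≢ c₂
      distinct c₁≡c₂ = Fin.<⇒≢ k₁<k₂ (trans (sym (join-splitAt (ℕ.suc h) (ℕ.suc h) k₁))
                                       (trans (cong (join (ℕ.suc h) (ℕ.suc h)) c₁≡c₂) (join-splitAt (ℕ.suc h) (ℕ.suc h) k₂)))

  odd-prime-four-squares : ∀ h → Prime (ℕ.suc (ℕ.suc h ℕ.+ ℕ.suc h)) →
    SumOfFourSquares (+ ℕ.suc (ℕ.suc h ℕ.+ ℕ.suc h))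
  odd-prime-four-squares h p-prime = from-root (minus-one-sum-of-two-squares H p-prime)
    where
    H = ℕ.suc h
    P = ℕ.suc (H ℕ.+ H)
    as-ℕ : ∀ x y → (+ x * + x + + y * + y) + (1ℤ * 1ℤ + 0ℤ * 0ℤ) ≡ + (x ℕ.* x ℕ.+ y ℕ.* y ℕ.+ 1)
    as-ℕ x y = trans (cong₂ (λ a b → a + b + 1ℤ) (sym (pos-* x x)) (sym (pos-* y y)))
                     (sym (trans (pos-+ (x ℕ.* x ℕ.+ y ℕ.* y) 1) (cong (_+ 1ℤ) (pos-+ (x ℕ.* x) (y ℕ.* y)))))
    expand : ∀ H → H ℕ.* H ℕ.+ H ℕ.* H ℕ.+ 1 ℕ.+ (H ℕ.* H ℕ.+ H ℕ.* H ℕ.+ 4 ℕ.* H)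
                   ≡ ℕ.suc (H ℕ.+ H) ℕ.* ℕ.suc (H ℕ.+ H)
    expand = ℕ-solve-∀
    from-root : MinusOneSumOfTwoSquares H P → SumOfFourSquares (+ P)
    from-root (x , y , x≤H , y≤H , P∣) = from-multiple (∣⇒∣ᵤ P∣)
      where
      small : x ℕ.* x ℕ.+ y ℕ.* y ℕ.+ 1 ℕ.< P ℕ.* P
      small = ℕ.≤-<-trans (ℕ.+-monoˡ-≤ 1 (ℕ.+-mono-≤ (ℕ.*-mono-≤ x≤H x≤H) (ℕ.*-mono-≤ y≤H y≤H)))
                (subst (H ℕ.* H ℕ.+ H ℕ.* H ℕ.+ 1 ℕ.<_) (expand H) (ℕ.m<m+n (H ℕ.* H ℕ.+ H ℕ.* H ℕ.+ 1) ℕ.z<s))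
      from-multiple : P ℕ.∣ x ℕ.* x ℕ.+ y ℕ.* y ℕ.+ 1 → SumOfFourSquares (+ P)
      from-multiple (ℕ.divides 0 x²+y²+1≡0) = contradiction (ℕ.m+n≡0⇒n≡0 (x ℕ.* x ℕ.+ y ℕ.* y) x²+y²+1≡0) (λ ())
      from-multiple (ℕ.divides (ℕ.suc j) x²+y²+1≡m·P) =
        euler-descent p-prime j m<P (quat (+ x) (+ y) 1ℤ 0ℤ , sym (begin
          (+ x * + x + + y * + y) + (1ℤ * 1ℤ + 0ℤ * 0ℤ) ≡⟨ as-ℕ x y ⟩
          + (x ℕ.* x ℕ.+ y ℕ.* y ℕ.+ 1)                 ≡⟨ cong +_ x²+y²+1≡m·P ⟩
          + (ℕ.suc j ℕ.* P)                             ≡⟨ pos-* (ℕ.suc j) P ⟩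
          +[1+ j ] * + P                                ∎))
        where
        m<P : ℕ.suc j ℕ.< P
        m<P = ℕ.*-cancelʳ-< P (ℕ.suc j) P (subst (ℕ._< P ℕ.* P) x²+y²+1≡m·P small)

  prime-four-squares : ∀ {p} → Prime p → SumOfFourSquares (+ p)
  prime-four-squares p-prime with prime-cases p-prime
  ... | inj₁ refl = quat 1ℤ 1ℤ 0ℤ 0ℤ , refl
  ... | inj₂ (h , refl) = odd-prime-four-squares h p-prime

  product-four-squares : ∀ ps → All Prime ps → SumOfFourSquares (+ product ps)
  product-four-squares List.[] All.[] = quat 1ℤ 0ℤ 0ℤ 0ℤ , refl
  product-four-squares (p List.∷ ps) (p-prime All.∷ ps-prime) =
    subst SumOfFourSquares (sym (pos-* p (product ps)))
      (four-squares-* (prime-four-squares p-prime) (product-four-squares ps ps-prime))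

  lagrange : ∀ n → SumOfFourSquares (+ n)
  lagrange 0 = quat 0ℤ 0ℤ 0ℤ 0ℤ , refl
  lagrange n@(ℕ.suc _) = subst (SumOfFourSquares ∘ +_) (sym isFactorisation) (product-four-squares factors factorsPrime)
    where
    open PrimeFactorisation (factorise n)

  positive≢0 : ∀ {c} → c > 0ℤ → c ≢ 0ℤ
  positive≢0 c>0 c≡0 = <⇒≢ c>0 (sym c≡0)

  positive-four-squares : ∀ {c} → c > 0ℤ → SumOfFourSquares c
  positive-four-squares {+ n} _ = lagrange n

open import Data.Nat using (ℕ; _+_; _*_)
open import Data.Integer using (ℤ)

mainTheorem1 : (k : ℕ) (v : Vector ℤ (4 * k + 2)) →
    IsIcubeColumn (4 * k + 2) v → SumOfTwoSquares (dot v v)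
mainTheorem1 k v (A , c , icube@(c>0 , _) , j , column≡v) =
  subst SumOfTwoSquares (sym (icube-column-norm A j v icube column≡v))
    (davenport-cassels c (similitude₂⇒rational-two-squares c
      (similitude-descend k 2 c (positive-four-squares c>0) (positive≢0 c>0) (icube⇒similitude A icube))))
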